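{- Let $0<\varepsilon<1$. Let $m$ be a positive integer and $p$ a prime number with $$(2-\varepsilon)(p^2+p+1)<m<2(p^2+p+1).$$ Suppose that $A\subseteq\mathbb{Z}_{p^2+p+1}$ satisfies $\delta_A(n)\geq 1$ for every $n\in\mathbb{Z}_{p^2+p+1}$. Then there is a subset $B\subseteq\mathbb{Z}_m$ with $|B|\leq 2|A|$ such that $\delta_B(n)\geq 1$ for every $n\in\mathbb{Z}_m$.
   Context: $\mathbb{Z}_m$ denotes the set of residue classes modulo $m$. For $A\subseteq\mathbb{Z}_m$ and $n\in\mathbb{Z}_m$, $\delta_A(n)$ denotes the number of ordered pairs $(x,y)$ with $x,y\in A$ and $n=x-y$ in $\mathbb{Z}_m$.
   Formalization: The parameter ε ranges over the rationals. -}

module Defs where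

open import Data.Nat using (ℕ; zero; suc; _+_; _*_; _∸_; _^_; _%_; _≡ᵇ_)
open import Data.Bool using (Bool; true; false; _∧_; if_then_else_)
open import Data.Fin using (Fin; toℕ)
open import Data.Fin.Subset using (Subset)
open import Data.Vec using (lookup)
open import Data.List using (List; map)
open import Data.Nat.ListAction using (sum)
open import Data.List using (allFin) public

-- x - y in Z_m, as the natural-number representative in {0,...,m-1}.
-- (Fin m represents Z_m; m = 0 is vacuous since Fin 0 is empty.)
diffMod : (m : ℕ) → Fin m → Fin m → ℕ
diffMod zero () _
diffMod (suc k) x y = (toℕ x + (suc k ∸ toℕ y)) % suc k

isRep : {m : ℕ} → Subset m → Fin m → Fin m → Fin m → Bool
isRep {m} A n x y = lookup A x ∧ lookup A y ∧ (toℕ n ≡ᵇ diffMod m x y)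

δ : {m : ℕ} → Subset m → Fin m → ℕ
δ {m} A n =
  sum (map (λ x → sum (map (λ y → if isRep A n x y then 1 else 0) (allFin m))) (allFin m))

q : ℕ → ℕ
q p = p ^ 2 + p + 1

{-# OPTIONS --safe #-}
-- Lift A ⊆ ℤ_q to A ∪ (A + q) ⊆ [0, 2q) (encoded as A ++ A) and reduce it modulo m; this at most
-- doubles |A|. If a − b ≡ r (mod q) with a, b ∈ A and 0 ≤ r < q, then r = a − b or r = (a + q) − b
-- exactly, so every r < q is an exact difference of the lifted set. As m < 2q, every residue n
-- modulo m has n < q or m − n < q, so n or −n is the reduction of such an exact difference.
module Submission where

open import Defs
open import Data.Bool using (true; false; T; if_then_else_)
open import Data.Bool.Properties using (T-∧)
open import Data.Fin using (Fin; zero; suc; toℕ; fromℕ<; _↑ˡ_; _↑ʳ_)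
open import Data.Fin.Properties using (toℕ<n; toℕ-fromℕ<; toℕ-↑ˡ; toℕ-↑ʳ; nonZeroIndex)
open import Data.Fin.Subset using (Subset; _∈_; ∣_∣; ⁅_⁆; _∪_; ⊥; inside; outside)
open import Data.Fin.Subset.Properties using (x∈⁅x⁆; x∈p∪q⁺; ∣⁅x⁆∣≡1; ∣⊥∣≡0)
open import Data.Integer as ℤ using (+_)
import Data.Integer.Properties as ℤ
open import Data.List using (List; _∷_; map)
open import Data.List.Membership.Propositional.Properties using (∈-allFin)
import Data.List.Membership.Propositional as List
import Data.List.Relation.Unary.Any as Any
open import Data.Nat as ℕ using (ℕ; suc; _+_; _*_; _∸_; _%_; _≤_; _<?_; z≤n; s≤s; NonZero; ≢-nonZero; >-nonZero)
open import Data.Nat.DivMod using (_mod_; m%n<n; m<n⇒m%n≡m; %-distribˡ-+; m%n%n≡m%n; [m+n]%n≡m%n)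
open import Data.Nat.ListAction using (sum)
open import Data.Nat.Properties
open import Data.Nat.Primality using (Prime)
open import Data.Product using (Σ-syntax; ∃-syntax; ∃₂; _×_; _,_)
open import Data.Rational using (ℚ; _<_; _-_; _/_; 0ℚ; 1ℚ; mkℚ)
open import Data.Rational using () renaming (_*_ to _*ℚ_)
open import Data.Rational.Properties using (normalize-coprime; drop-*<*)
open import Data.Nat.Coprimality using (1-coprimeTo) renaming (sym to coprime-sym)
open import Data.Sum using (_⊎_; inj₁; inj₂)
open import Data.Vec using ([]; _∷_; _++_; lookup; here; there)
open import Function using (_∘_; _⇔_; mk⇔; Equivalence)
open import Relation.Binary.PropositionalEquality
open import Relation.Nullary using (yes; no)

open Equivalence using (to; from)

private variable
  k l : ℕ

≤-sum-map : ∀ {A : Set} (f : A → ℕ) {x xs} → x List.∈ xs → f x ≤ sum (map f xs)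
≤-sum-map f {xs = y ∷ ys} (Any.here refl) = m≤m+n (f y) _
≤-sum-map f {xs = y ∷ ys} (Any.there x∈ys) = ≤-trans (≤-sum-map f x∈ys) (m≤n+m _ (f y))

1≤sum-map⇒∃ : ∀ {A : Set} (f : A → ℕ) (xs : List A) → 1 ≤ sum (map f xs) → ∃[ x ] 1 ≤ f x
1≤sum-map⇒∃ f (x ∷ xs) 1≤sum with f x in fx≡
... | 0     = 1≤sum-map⇒∃ f xs 1≤sum
... | suc _ = x , subst (1 ≤_) (sym fx≡) (s≤s z≤n)

1≤indicator⇔T : ∀ {b} → 1 ≤ (if b then 1 else 0) ⇔ T b
1≤indicator⇔T {true}  = mk⇔ _ (λ _ → ≤-refl)
1≤indicator⇔T {false} = mk⇔ (λ ()) (λ ())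

T-lookup⇔∈ : ∀ {p : Subset k} {x} → T (lookup p x) ⇔ x ∈ p
T-lookup⇔∈ {p = inside  ∷ p} {zero}  = mk⇔ (λ _ → here) _
T-lookup⇔∈ {p = outside ∷ p} {zero}  = mk⇔ (λ ()) (λ ())
T-lookup⇔∈ {p = _       ∷ p} {suc x} =
  mk⇔ (there ∘ T-lookup⇔∈ {p = p} .to) (λ { (there x∈p) → T-lookup⇔∈ {p = p} .from x∈p })

∣p∪q∣≤∣p∣+∣q∣ : (p q : Subset k) → ∣ p ∪ q ∣ ≤ ∣ p ∣ + ∣ q ∣
∣p∪q∣≤∣p∣+∣q∣ []            []            = z≤n
∣p∪q∣≤∣p∣+∣q∣ (inside  ∷ p) (inside  ∷ q) =
  s≤s (≤-trans (∣p∪q∣≤∣p∣+∣q∣ p q) (+-monoʳ-≤ ∣ p ∣ (n≤1+n ∣ q ∣)))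
∣p∪q∣≤∣p∣+∣q∣ (inside  ∷ p) (outside ∷ q) = s≤s (∣p∪q∣≤∣p∣+∣q∣ p q)
∣p∪q∣≤∣p∣+∣q∣ (outside ∷ p) (inside  ∷ q) =
  ≤-trans (s≤s (∣p∪q∣≤∣p∣+∣q∣ p q)) (≤-reflexive (sym (+-suc ∣ p ∣ ∣ q ∣)))
∣p∪q∣≤∣p∣+∣q∣ (outside ∷ p) (outside ∷ q) = ∣p∪q∣≤∣p∣+∣q∣ p q

∣p++q∣≡∣p∣+∣q∣ : (p : Subset k) (q : Subset l) → ∣ p ++ q ∣ ≡ ∣ p ∣ + ∣ q ∣
∣p++q∣≡∣p∣+∣q∣ []            q = refl
∣p++q∣≡∣p∣+∣q∣ (inside  ∷ p) q = cong suc (∣p++q∣≡∣p∣+∣q∣ p q)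
∣p++q∣≡∣p∣+∣q∣ (outside ∷ p) q = ∣p++q∣≡∣p∣+∣q∣ p q

x∈p⇒x↑ˡ∈p++q : ∀ {p : Subset k} {x} (q : Subset l) → x ∈ p → x ↑ˡ l ∈ p ++ q
x∈p⇒x↑ˡ∈p++q q here        = here
x∈p⇒x↑ˡ∈p++q q (there x∈p) = there (x∈p⇒x↑ˡ∈p++q q x∈p)

x∈q⇒k↑ʳx∈p++q : ∀ (p : Subset k) {q : Subset l} {x} → x ∈ q → k ↑ʳ x ∈ p ++ q
x∈q⇒k↑ʳx∈p++q []      x∈q = x∈q
x∈q⇒k↑ʳx∈p++q (_ ∷ p) x∈q = there (x∈q⇒k↑ʳx∈p++q p x∈q)

image : (Fin k → Fin l) → Subset k → Subset l
image f []            = ⊥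
image f (inside  ∷ p) = ⁅ f zero ⁆ ∪ image (f ∘ suc) p
image f (outside ∷ p) = image (f ∘ suc) p

x∈p⇒fx∈image : ∀ (f : Fin k → Fin l) {p x} → x ∈ p → f x ∈ image f p
x∈p⇒fx∈image f {inside ∷ p} here        = x∈p∪q⁺ (inj₁ (x∈⁅x⁆ (f zero)))
x∈p⇒fx∈image f {inside ∷ p} (there x∈p) = x∈p∪q⁺ (inj₂ (x∈p⇒fx∈image (f ∘ suc) x∈p))
x∈p⇒fx∈image f {outside ∷ p} (there x∈p) = x∈p⇒fx∈image (f ∘ suc) x∈p

∣image∣≤∣p∣ : (f : Fin k → Fin l) (p : Subset k) → ∣ image f p ∣ ≤ ∣ p ∣
∣image∣≤∣p∣ {l = l} f [] = ≤-reflexive (∣⊥∣≡0 l)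
∣image∣≤∣p∣ f (inside ∷ p) = begin
  ∣ ⁅ f zero ⁆ ∪ image (f ∘ suc) p ∣       ≤⟨ ∣p∪q∣≤∣p∣+∣q∣ ⁅ f zero ⁆ (image (f ∘ suc) p) ⟩
  (∣ ⁅ f zero ⁆ ∣) + ∣ image (f ∘ suc) p ∣ ≡⟨ cong (_+ ∣ image (f ∘ suc) p ∣) (∣⁅x⁆∣≡1 (f zero)) ⟩
  suc ∣ image (f ∘ suc) p ∣                ≤⟨ s≤s (∣image∣≤∣p∣ (f ∘ suc) p) ⟩
  suc ∣ p ∣                                ∎
  where open ≤-Reasoning
∣image∣≤∣p∣ f (outside ∷ p) = ∣image∣≤∣p∣ (f ∘ suc) p

[m%o+n]%o≡[m+n]%o : ∀ m n o .{{_ : NonZero o}} → (m % o + n) % o ≡ (m + n) % o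
[m%o+n]%o≡[m+n]%o m n o = begin
  (m % o + n) % o         ≡⟨ %-distribˡ-+ (m % o) n o ⟩
  (m % o % o + n % o) % o ≡⟨ cong (λ r → (r + n % o) % o) (m%n%n≡m%n m o) ⟩
  (m % o + n % o) % o     ≡⟨ %-distribˡ-+ m n o ⟨
  (m + n) % o             ∎
  where open ≡-Reasoning

m%n≡o⇒m≡o⊎m≡o+n : ∀ {m n o} .{{_ : NonZero n}} → m ℕ.< n + n → m % n ≡ o → m ≡ o ⊎ m ≡ o + n
m%n≡o⇒m≡o⊎m≡o+n {m} {n} {o} m<n+n m%n≡o with m <? n
... | yes m<n = inj₁ (trans (sym (m<n⇒m%n≡m m<n)) m%n≡o)
... | no  m≮n = inj₂ (begin
  m           ≡⟨ m∸n+n≡m (≮⇒≥ m≮n) ⟨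
  m ∸ n + n   ≡⟨ cong (_+ n) m∸n≡o ⟩
  o + n       ∎)
  where
  open ≡-Reasoning
  m∸n≡o : m ∸ n ≡ o
  m∸n≡o = begin
    m ∸ n             ≡⟨ m<n⇒m%n≡m (m<n+o⇒m∸n<o m n m<n+n) ⟨
    (m ∸ n) % n       ≡⟨ [m+n]%n≡m%n (m ∸ n) n ⟨
    (m ∸ n + n) % n   ≡⟨ cong (_% n) (m∸n+n≡m (≮⇒≥ m≮n)) ⟩
    m % n             ≡⟨ m%n≡o ⟩
    o                 ∎

diffMod≡ : .{{_ : NonZero k}} (x y : Fin k) → diffMod k x y ≡ (toℕ x + (k ∸ toℕ y)) % k
diffMod≡ {suc _} x  y = refl

toℕ≡diffMod⇔ : .{{_ : NonZero k}} (n x y : Fin k) →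
               toℕ n ≡ diffMod k x y ⇔ (toℕ y + toℕ n) % k ≡ toℕ x
toℕ≡diffMod⇔ {k} n x y = mk⇔ to′ from′
  where
  open ≡-Reasoning
  y≤k : toℕ y ≤ k
  y≤k = <⇒≤ (toℕ<n y)

  to′ : toℕ n ≡ diffMod k x y → (toℕ y + toℕ n) % k ≡ toℕ x
  to′ n≡ = begin
    (toℕ y + toℕ n) % k                          ≡⟨ cong (_% k) (+-comm (toℕ y) (toℕ n)) ⟩
    (toℕ n + toℕ y) % k                          ≡⟨ cong (λ r → (r + toℕ y) % k) (trans n≡ (diffMod≡ x y)) ⟩
    ((toℕ x + (k ∸ toℕ y)) % k + toℕ y) % k      ≡⟨ [m%o+n]%o≡[m+n]%o (toℕ x + (k ∸ toℕ y)) (toℕ y) k ⟩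
    (toℕ x + (k ∸ toℕ y) + toℕ y) % k            ≡⟨ cong (_% k) (+-assoc (toℕ x) _ (toℕ y)) ⟩
    (toℕ x + (k ∸ toℕ y + toℕ y)) % k            ≡⟨ cong (λ r → (toℕ x + r) % k) (m∸n+n≡m y≤k) ⟩
    (toℕ x + k) % k                              ≡⟨ [m+n]%n≡m%n (toℕ x) k ⟩
    toℕ x % k                                    ≡⟨ m<n⇒m%n≡m (toℕ<n x) ⟩
    toℕ x                                        ∎

  from′ : (toℕ y + toℕ n) % k ≡ toℕ x → toℕ n ≡ diffMod k x y
  from′ y+n≡x = sym (begin
    diffMod k x y                                ≡⟨ diffMod≡ x y ⟩
    (toℕ x + (k ∸ toℕ y)) % k                    ≡⟨ cong (λ r → (r + (k ∸ toℕ y)) % k) y+n≡x ⟨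
    ((toℕ y + toℕ n) % k + (k ∸ toℕ y)) % k      ≡⟨ [m%o+n]%o≡[m+n]%o (toℕ y + toℕ n) (k ∸ toℕ y) k ⟩
    (toℕ y + toℕ n + (k ∸ toℕ y)) % k            ≡⟨ cong (λ r → (r + (k ∸ toℕ y)) % k) (+-comm (toℕ y) (toℕ n)) ⟩
    (toℕ n + toℕ y + (k ∸ toℕ y)) % k            ≡⟨ cong (_% k) (+-assoc (toℕ n) (toℕ y) _) ⟩
    (toℕ n + (toℕ y + (k ∸ toℕ y))) % k          ≡⟨ cong (λ r → (toℕ n + r) % k) (m+[n∸m]≡n y≤k) ⟩
    (toℕ n + k) % k                              ≡⟨ [m+n]%n≡m%n (toℕ n) k ⟩
    toℕ n % k                                    ≡⟨ m<n⇒m%n≡m (toℕ<n n) ⟩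
    toℕ n                                        ∎)

1≤δ⇔∃isRep : (A : Subset k) (n : Fin k) → 1 ≤ δ A n ⇔ ∃₂ λ x y → T (isRep A n x y)
1≤δ⇔∃isRep {k} A n = mk⇔ to′ from′
  where
  row : Fin k → ℕ
  row x = sum (map (λ y → if isRep A n x y then 1 else 0) (allFin k))

  to′ : 1 ≤ δ A n → ∃₂ λ x y → T (isRep A n x y)
  to′ 1≤δ =
    let x , 1≤row = 1≤sum-map⇒∃ row (allFin k) 1≤δ
        y , 1≤ind = 1≤sum-map⇒∃ _ (allFin k) 1≤row
    in x , y , 1≤indicator⇔T .to 1≤ind

  from′ : (∃₂ λ x y → T (isRep A n x y)) → 1 ≤ δ A n
  from′ (x , y , rep) = ≤-trans (≤-trans (1≤indicator⇔T .from rep) (≤-sum-map _ (∈-allFin y)))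
                                (≤-sum-map row (∈-allFin x))

T-isRep⇔ : (A : Subset k) (n x y : Fin k) →
           T (isRep A n x y) ⇔ (x ∈ A × y ∈ A × toℕ n ≡ diffMod k x y)
T-isRep⇔ {k} A n x y = mk⇔ to′ from′
  where
  to′ : T (isRep A n x y) → x ∈ A × y ∈ A × toℕ n ≡ diffMod k x y
  to′ rep = let x∈A , rest = T-∧ .to rep
                y∈A , n≡  = T-∧ .to rest
            in T-lookup⇔∈ .to x∈A , T-lookup⇔∈ .to y∈A , ≡ᵇ⇒≡ _ _ n≡

  from′ : x ∈ A × y ∈ A × toℕ n ≡ diffMod k x y → T (isRep A n x y)
  from′ (x∈A , y∈A , n≡) =
    T-∧ .from (T-lookup⇔∈ .from x∈A , T-∧ .from (T-lookup⇔∈ .from y∈A , ≡⇒≡ᵇ _ _ n≡))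

IsDifferenceBasis : Subset k → Set
IsDifferenceBasis A = ∀ n → 1 ≤ δ A n

IsDifference : .{{_ : NonZero k}} → Subset k → Fin k → Set
IsDifference {k} A n = ∃₂ λ x y → x ∈ A × y ∈ A × (toℕ y + toℕ n) % k ≡ toℕ x

1≤δ⇔IsDifference : .{{_ : NonZero k}} (A : Subset k) (n : Fin k) → 1 ≤ δ A n ⇔ IsDifference A n
1≤δ⇔IsDifference A n = mk⇔ to′ from′
  where
  to′ : 1 ≤ δ A n → IsDifference A n
  to′ 1≤δ = let x , y , rep = 1≤δ⇔∃isRep A n .to 1≤δ
                x∈A , y∈A , n≡ = T-isRep⇔ A n x y .to rep
            in x , y , x∈A , y∈A , toℕ≡diffMod⇔ n x y .to n≡

  from′ : IsDifference A n → 1 ≤ δ A n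
  from′ (x , y , x∈A , y∈A , y+n≡x) =
    1≤δ⇔∃isRep A n .from
      (x , y , T-isRep⇔ A n x y .from (x∈A , y∈A , toℕ≡diffMod⇔ n x y .from y+n≡x))

IsℕDifference : Subset k → ℕ → Set
IsℕDifference S r = ∃₂ λ u v → u ∈ S × v ∈ S × toℕ v + r ≡ toℕ u

IsDifference⇒IsℕDifference-++ : .{{_ : NonZero k}} {A : Subset k} {n : Fin k} →
                                IsDifference A n → IsℕDifference (A ++ A) (toℕ n)
IsDifference⇒IsℕDifference-++ {k} {A} {n} (x , y , x∈A , y∈A , [y+n]%k≡x)
  with m%n≡o⇒m≡o⊎m≡o+n (+-mono-< (toℕ<n y) (toℕ<n n)) [y+n]%k≡x
... | inj₁ y+n≡x   = x ↑ˡ k , y ↑ˡ k , x∈p⇒x↑ˡ∈p++q A x∈A , x∈p⇒x↑ˡ∈p++q A y∈A , (begin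
  toℕ (y ↑ˡ k) + toℕ n  ≡⟨ cong (_+ toℕ n) (toℕ-↑ˡ y k) ⟩
  toℕ y + toℕ n         ≡⟨ y+n≡x ⟩
  toℕ x                 ≡⟨ toℕ-↑ˡ x k ⟨
  toℕ (x ↑ˡ k)          ∎)
  where open ≡-Reasoning
... | inj₂ y+n≡x+k = k ↑ʳ x , y ↑ˡ k , x∈q⇒k↑ʳx∈p++q A x∈A , x∈p⇒x↑ˡ∈p++q A y∈A , (begin
  toℕ (y ↑ˡ k) + toℕ n  ≡⟨ cong (_+ toℕ n) (toℕ-↑ˡ y k) ⟩
  toℕ y + toℕ n         ≡⟨ y+n≡x+k ⟩
  toℕ x + k             ≡⟨ +-comm (toℕ x) k ⟩
  k + toℕ x             ≡⟨ toℕ-↑ʳ k x ⟨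
  toℕ (k ↑ʳ x)          ∎)
  where open ≡-Reasoning

IsDifferenceBasis⇒IsℕDifference-++ : (A : Subset k) → IsDifferenceBasis A →
                                     ∀ {r} → r ℕ.< k → IsℕDifference (A ++ A) r
IsDifferenceBasis⇒IsℕDifference-++ {k} A basis r<k =
  subst (IsℕDifference (A ++ A)) (toℕ-fromℕ< r<k)
        (IsDifference⇒IsℕDifference-++ (1≤δ⇔IsDifference A n .to (basis n)))
  where
  n : Fin k
  n = fromℕ< r<k
  instance
    k≢0 : NonZero k
    k≢0 = nonZeroIndex n

reduce : ∀ m .{{_ : NonZero m}} → Fin k → Fin m
reduce m u = toℕ u mod m

toℕ-reduce : ∀ m .{{_ : NonZero m}} (u : Fin k) → toℕ (reduce m u) ≡ toℕ u % m
toℕ-reduce m u = toℕ-fromℕ< (m%n<n (toℕ u) m)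

module _ {m : ℕ} .{{_ : NonZero m}} (S : Subset k) where

  IsDifference-image-reduce : ∀ {u v} (n : Fin m) → u ∈ S → v ∈ S →
                              (toℕ v + toℕ n) % m ≡ toℕ u % m → IsDifference (image (reduce m) S) n
  IsDifference-image-reduce {u} {v} n u∈S v∈S [v+n]%m≡u%m =
    reduce m u , reduce m v , x∈p⇒fx∈image (reduce m) u∈S , x∈p⇒fx∈image (reduce m) v∈S , (begin
      (toℕ (reduce m v) + toℕ n) % m  ≡⟨ cong (λ r → (r + toℕ n) % m) (toℕ-reduce m v) ⟩
      (toℕ v % m + toℕ n) % m         ≡⟨ [m%o+n]%o≡[m+n]%o (toℕ v) (toℕ n) m ⟩
      (toℕ v + toℕ n) % m             ≡⟨ [v+n]%m≡u%m ⟩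
      toℕ u % m                       ≡⟨ toℕ-reduce m u ⟨
      toℕ (reduce m u)                ∎)
    where open ≡-Reasoning

  IsℕDifference⇒IsDifference-image : (n : Fin m) → IsℕDifference S (toℕ n) →
                                     IsDifference (image (reduce m) S) n
  IsℕDifference⇒IsDifference-image n (u , v , u∈S , v∈S , v+n≡u) =
    IsDifference-image-reduce n u∈S v∈S (cong (_% m) v+n≡u)

  IsℕDifference-neg⇒IsDifference-image : (n : Fin m) → IsℕDifference S (m ∸ toℕ n) →
                                         IsDifference (image (reduce m) S) n
  IsℕDifference-neg⇒IsDifference-image n (u , v , u∈S , v∈S , v+[m∸n]≡u) =
    IsDifference-image-reduce n v∈S u∈S (begin
      (toℕ u + toℕ n) % m               ≡⟨ cong (λ r → (r + toℕ n) % m) v+[m∸n]≡u ⟨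
      (toℕ v + (m ∸ toℕ n) + toℕ n) % m ≡⟨ cong (_% m) (+-assoc (toℕ v) _ (toℕ n)) ⟩
      (toℕ v + (m ∸ toℕ n + toℕ n)) % m ≡⟨ cong (λ r → (toℕ v + r) % m) (m∸n+n≡m (<⇒≤ (toℕ<n n))) ⟩
      (toℕ v + m) % m                   ≡⟨ [m+n]%n≡m%n (toℕ v) m ⟩
      toℕ v % m                         ∎)
    where open ≡-Reasoning

difference-basis-reduction : ∀ {q m} .{{_ : NonZero m}} → m ℕ.< 2 * q →
                             (A : Subset q) → IsDifferenceBasis A →
                             Σ[ B ∈ Subset m ] (∣ B ∣ ≤ 2 * ∣ A ∣ × IsDifferenceBasis B)
difference-basis-reduction {q} {m} m<2q A basis = image (reduce m) (A ++ A) , ∣B∣≤2∣A∣ , B-basis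
  where
  m<q+q : m ℕ.< q + q
  m<q+q = subst (m ℕ.<_) (cong (λ r → q + r) (+-identityʳ q)) m<2q

  instance
    q≢0 : NonZero q
    q≢0 = ≢-nonZero (λ q≡0 → n≮0 (subst (λ r → m ℕ.< r + r) q≡0 m<q+q))

  ∣B∣≤2∣A∣ : ∣ image (reduce m) (A ++ A) ∣ ≤ 2 * ∣ A ∣
  ∣B∣≤2∣A∣ = begin
    ∣ image (reduce m) (A ++ A) ∣  ≤⟨ ∣image∣≤∣p∣ (reduce m) (A ++ A) ⟩
    ∣ A ++ A ∣                     ≡⟨ ∣p++q∣≡∣p∣+∣q∣ A A ⟩
    ∣ A ∣ + ∣ A ∣                  ≡⟨ cong (λ r → ∣ A ∣ + r) (+-identityʳ ∣ A ∣) ⟨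
    2 * ∣ A ∣                      ∎
    where open ≤-Reasoning

  B-basis : IsDifferenceBasis (image (reduce m) (A ++ A))
  B-basis n with toℕ n <? q
  ... | yes n<q = 1≤δ⇔IsDifference _ n .from
    (IsℕDifference⇒IsDifference-image (A ++ A) n (IsDifferenceBasis⇒IsℕDifference-++ A basis n<q))
  ... | no  n≮q = 1≤δ⇔IsDifference _ n .from
    (IsℕDifference-neg⇒IsDifference-image (A ++ A) n (IsDifferenceBasis⇒IsℕDifference-++ A basis m∸n<q))
    where
    m∸n<q : m ∸ toℕ n ℕ.< q
    m∸n<q = ≤-<-trans (∸-monoʳ-≤ m (≮⇒≥ n≮q)) (m<n+o⇒m∸n<o m q m<q+q)

n/1≡mkℚ : ∀ n → + n / 1 ≡ mkℚ (+ n) 0 (coprime-sym (1-coprimeTo n))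
n/1≡mkℚ n = normalize-coprime (coprime-sym (1-coprimeTo n))

m/1*n/1≡[m*n]/1 : ∀ m n → (+ m / 1) *ℚ (+ n / 1) ≡ + (m * n) / 1
m/1*n/1≡[m*n]/1 m n = trans (cong₂ _*ℚ_ (n/1≡mkℚ m) (n/1≡mkℚ n)) (cong (_/ 1) (sym (ℤ.pos-* m n)))

m/1<n/1⇒m<n : ∀ {m n} → + m / 1 < + n / 1 → m ℕ.< n
m/1<n/1⇒m<n {m} {n} m/1<n/1 = ℤ.drop‿+<+ (subst₂ ℤ._<_ (ℤ.*-identityʳ (+ m)) (ℤ.*-identityʳ (+ n))
  (drop-*<* (subst₂ _<_ (n/1≡mkℚ m) (n/1≡mkℚ n) m/1<n/1)))

lemma3p3 : (ε : ℚ) → 0ℚ < ε → ε < 1ℚ →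
    (m : ℕ) → 1 ≤ m → (p : ℕ) → Prime p →
    ((+ 2 / 1) - ε) *ℚ (+ q p / 1) < (+ m / 1) →
    (+ m / 1) < (+ 2 / 1) *ℚ (+ q p / 1) →
    (A : Subset (q p)) → ((n : Fin (q p)) → 1 ≤ δ A n) →
    Σ[ B ∈ Subset m ] (∣ B ∣ ≤ 2 * ∣ A ∣ × ((n : Fin m) → 1 ≤ δ B n))
lemma3p3 _ _ _ m 1≤m p _ _ m<2q A basis =
  difference-basis-reduction {{>-nonZero 1≤m}} m<2*q A basis
  where
  m<2*q : m ℕ.< 2 * q p
  m<2*q = m/1<n/1⇒m<n (subst (+ m / 1 <_) (m/1*n/1≡[m*n]/1 2 (q p)) m<2q)
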